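{- Let $\widetilde{\Upsilon}$ be the transformed alignment of $m$ similar strings $S^1,\dots,S^m$ as described in the context, with suffix array of alignment $SAA[1..n]$ and arrays $F$, $L$. Let $i\in\{1,\dots,n\}$ and let $\sigma\in L[i]$. Then there is a single index $k\in\{1,\dots,n\}$ such that for every suffix $(j,q)$ in $SAA[i]$ whose preceding character $\widetilde{S}^j[q']$ equals $\sigma$, the suffix $(j,q')$ belongs to $SAA[k]$. In other words, all characters of $L[i]$ whose value is $\sigma$ are contained in one identical entry $F[k]$.
   Context: Setting. Let $\Sigma$ be a totally ordered alphabet and let $S^1,\dots,S^m$ be strings with $S^j=\alpha_1\Delta^j_1\alpha_2\Delta^j_2\cdots\alpha_r\Delta^j_r\alpha_{r+1}$ for $1\le j\le m$, where each $\alpha_i$ ($1\le i\le r+1$) is a nonempty common substring (the same in all strings) and each $\Delta^j_i$ ($1\le i\le r$) is a (possibly empty) non-common substring. $\alpha_1$ starts with the special symbol $\$$ and $\alpha_{r+1}$ ends with the special symbol $\#$, and $\$,\#$ occur nowhere else in any $S^j$. For $1\le i\le r$, $\tilde{\alpha}^{+}_i$ is the shortest suffix of $\alpha_i$ that occurs exactly once in each string $S^j$ ($1\le j\le m$); $\tilde{\alpha}^{+}_{r+1}$ is the empty string. Standing assumption: for $2\le i\le r+1$, $\tilde{\alpha}^{+}_i$ is strictly shorter than $\alpha_i$. Let $\tilde{\alpha}^{\diamond}_i$ be the prefix of $\alpha_i$ with $\alpha_i=\tilde{\alpha}^{\diamond}_i\tilde{\alpha}^{+}_i$. Transformed alignment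 $\widetilde{\Upsilon}$: a grid with $m$ rows and columns (positions) $1,\dots,N$, consisting consecutively of: a block of $|\tilde{\alpha}^{\diamond}_1|$ columns (a cs-region) in which every row contains $\tilde{\alpha}^{\diamond}_1$; then a block of $w_1=\max_j|\tilde{\alpha}^{+}_1\Delta^j_1|$ columns (a ps-region) in which row $j$ contains $\tilde{\alpha}^{+}_1\Delta^j_1$ right-justified, i.e. preceded by $w_1-|\tilde{\alpha}^{+}_1\Delta^j_1|$ empty cells (gaps); then the cs-region for $\tilde{\alpha}^{\diamond}_2$, the ps-region for $\tilde{\alpha}^{+}_2\Delta_2$, and so on, ending with the cs-region for $\tilde{\alpha}^{\diamond}_{r+1}$. $\widetilde{S}^j[q]$ denotes the cell of row $j$ at column $q$ (either a character or empty). Reading the nonempty cells of row $j$ left to right gives $S^j$. For a nonempty cell $\widetilde{S}^j[q]$, the suffix $(j,q)$ is the string formed by the nonempty cells of row $j$ at columns $\ge q$. Its preceding character is $\widetilde{S}^j[q']$ where $q'$ is the largest column $<q$ with $\widetilde{S}^j[q']$ nonempty; if no such column exists (i.e. $q=1$), cyclically the preceding character is the final $\#$ at column $q'=N$. Alignment-suffixes (a-suffixes). If column $q$ lies in a cs-region, all suffixes $(j,q)$, $1\le j\le m$, together form one a-suffix. If $q$ lies in the ps-region of $\tilde{\alpha}^{+}_i\Delta_i$, let $\delta^j_i$ be the content of row $j$ in columns $q$ through the end of that ps-region (nonempty cells only); the suffixes $(j,q)$ with $\widetilde{S}^j[q]$ nonempty are partitioned so that $(j_1,q)$ and $(j_2,q)$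 are in the same class iff $\delta^{j_1}_i=\delta^{j_2}_i$; each class is one a-suffix. The suffixes belonging to one a-suffix are consecutive in the lexicographic order of all suffixes of all strings; the suffix array of alignment $SAA[1..n]$ lists all a-suffixes in the induced lexicographic order. $F[i]$ is the set of first characters of the suffixes in $SAA[i]$ (a single character), and $L[i]$ is the set of preceding characters of the suffixes in $SAA[i]$. -}

module Defs where

open import Data.Nat using (ℕ; zero; suc; _+_; _∸_; _<_; _⊔_; _<ᵇ_)
open import Data.Fin using (Fin; inject₁) renaming (zero to fzero; suc to fsuc)
open import Data.List using (List; []; _∷_; _++_; length; replicate; map; concat; take; drop; foldr; allFin; [_]; catMaybes)
open import Data.Vec using (Vec; lookup; last; init; zipWith; tabulate) renaming ([] to []ᵥ; _∷_ to _∷ᵥ_)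
open import Data.Maybe using (Maybe; just; nothing)
open import Data.Product using (Σ; _×_; _,_; proj₂)
open import Data.Sum using (_⊎_)
open import Data.Unit using (⊤)
open import Data.Empty using (⊥)
open import Data.Bool using (if_then_else_)
open import Relation.Binary.PropositionalEquality using (_≡_; _≢_)
open import Relation.Nullary using (¬_)

module _ {A : Set} where

  OccursAt : List A → List A → ℕ → Set
  OccursAt s S p = Σ (List A) λ pre → Σ (List A) λ post →
                     (S ≡ pre ++ s ++ post) × (length pre ≡ p)

  OccursOnce : List A → List A → Set
  OccursOnce s S = Σ ℕ λ p → OccursAt s S p × (∀ p' → OccursAt s S p' → p' ≡ p)

  IsSuffix : List A → List A → Set
  IsSuffix s t = Σ (List A) λ pre → t ≡ pre ++ s

  interleave : ∀ {r} → Vec (List A) (suc r) → Vec (List A) r → List A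
  interleave {zero} (a ∷ᵥ []ᵥ) []ᵥ = a
  interleave {suc r} (a ∷ᵥ as) (d ∷ᵥ ds) = a ++ d ++ interleave as ds

  -- right-justify s in a block of width w (gaps = nothing)
  pad : ℕ → List A → List (Maybe A)
  pad w s = replicate (w ∸ length s) nothing ++ map just s

  cellAt : List (Maybe A) → ℕ → Maybe A
  cellAt [] q = nothing
  cellAt (x ∷ xs) zero = x
  cellAt (x ∷ xs) (suc q) = cellAt xs q

data Kind : Set where
  csR psR : Kind

module _ {A : Set} where

  -- blocks of one row: cs-region α◇₁, ps-region (α⁺₁Δ₁ padded to w₁), ..., cs-region α◇_{r+1}
  rowBlocks : ∀ {r} → Vec (List A) (suc r) → Vec (List A) r → Vec ℕ r → List (Kind × List (Maybe A))
  rowBlocks {zero} (a ∷ᵥ []ᵥ) []ᵥ []ᵥ = (csR , map just a) ∷ []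
  rowBlocks {suc r} (a ∷ᵥ as) (c ∷ᵥ cs) (w ∷ᵥ ws) =
    (csR , map just a) ∷ (psR , pad w c) ∷ rowBlocks as cs ws

  layout : ∀ {r} → Vec (List A) (suc r) → Vec ℕ r → List (Kind × ℕ)
  layout {zero} (a ∷ᵥ []ᵥ) []ᵥ = (csR , length a) ∷ []
  layout {suc r} (a ∷ᵥ as) (w ∷ᵥ ws) = (csR , length a) ∷ (psR , w) ∷ layout as ws

-- region containing column q (0-based): its kind and its end column (exclusive)
regionFrom : ℕ → List (Kind × ℕ) → ℕ → Maybe (Kind × ℕ)
regionFrom off [] q = nothing
regionFrom off ((k , w) ∷ bs) q =
  if q <ᵇ off + w then just (k , off + w) else regionFrom (off + w) bs q

-- The input data: m strings S^j = α₁Δ^j₁ ⋯ α_rΔ^j_r α_{r+1}, together with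
-- the chosen suffixes α̃⁺_i (index i ∈ Fin (suc r) is the paper's i+1)

record Input : Set₁ where
  field
    Char   : Set
    dollar : Char
    hash   : Char
    m      : ℕ
    r      : ℕ
    α      : Vec (List Char) (suc r)
    Δ      : Fin m → Vec (List Char) r
    αplus  : Vec (List Char) (suc r)

  S : Fin m → List Char
  S j = interleave α (Δ j)

record WellFormed (I : Input) : Set where
  open Input I
  field
    dollar≢hash  : dollar ≢ hash
    α-nonempty   : ∀ i → lookup α i ≢ []
    α₁-starts-$  : Σ (List Char) λ t → lookup α fzero ≡ dollar ∷ t
    αlast-ends-# : Σ (List Char) λ t → last α ≡ t ++ [ hash ]
    $-once       : ∀ j → OccursOnce [ dollar ] (S j)
    #-once       : ∀ j → OccursOnce [ hash ] (S j)
    plus-suffix   : ∀ (i : Fin r) → IsSuffix (lookup αplus (inject₁ i)) (lookup α (inject₁ i))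
    plus-once     : ∀ (i : Fin r) j → OccursOnce (lookup αplus (inject₁ i)) (S j)
    plus-shortest : ∀ (i : Fin r) (s : List Char) → IsSuffix s (lookup α (inject₁ i)) →
                    length s < length (lookup αplus (inject₁ i)) → ¬ (∀ j → OccursOnce s (S j))
    plus-last     : last αplus ≡ []
    standing      : ∀ (i : Fin r) → length (lookup αplus (fsuc i)) < length (lookup α (fsuc i))

-- The transformed alignment Υ̃ (columns are 0-based: 0 … N-1)

module Alignment (I : Input) where
  open Input I

  -- α̃◇_i with α_i = α̃◇_i α̃⁺_i
  diamonds : Vec (List Char) (suc r)
  diamonds = zipWith (λ a p → take (length a ∸ length p) a) α αplus

  psContent : Fin m → Vec (List Char) r
  psContent j = zipWith _++_ (init αplus) (Δ j)

  widths : Vec ℕ r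
  widths = tabulate λ i → foldr _⊔_ 0 (map (λ j → length (lookup (psContent j) i)) (allFin m))

  blocks : List (Kind × ℕ)
  blocks = layout diamonds widths

  N : ℕ
  N = foldr (λ b n → proj₂ b + n) 0 blocks

  row : Fin m → List (Maybe Char)
  row j = concat (map proj₂ (rowBlocks diamonds (psContent j) widths))

  cell : Fin m → ℕ → Maybe Char
  cell j q = cellAt (row j) q

  Nonempty : Fin m → ℕ → Set
  Nonempty j q = Σ Char λ c → cell j q ≡ just c

  -- q' is the column of the preceding character of suffix (j,q) (cyclically N-1)
  IsPrev : Fin m → ℕ → ℕ → Set
  IsPrev j q q' =
      (q' < q × Nonempty j q' × (∀ q'' → q' < q'' → q'' < q → cell j q'' ≡ nothing))
    ⊎ ((∀ q'' → q'' < q → cell j q'' ≡ nothing) × q' ≡ N ∸ 1)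

  region : ℕ → Maybe (Kind × ℕ)
  region q = regionFrom 0 blocks q

  δ : Fin m → ℕ → ℕ → List Char
  δ j q e = catMaybes (take (e ∸ q) (drop q (row j)))

  sameRule : Maybe (Kind × ℕ) → Fin m → Fin m → ℕ → Set
  sameRule nothing j₁ j₂ q = ⊥
  sameRule (just (csR , e)) j₁ j₂ q = ⊤
  sameRule (just (psR , e)) j₁ j₂ q = δ j₁ q e ≡ δ j₂ q e

  SameASuffix : Fin m → ℕ → Fin m → ℕ → Set
  SameASuffix j₁ q₁ j₂ q₂ =
    q₁ ≡ q₂ × Nonempty j₁ q₁ × Nonempty j₂ q₂ × sameRule (region q₁) j₁ j₂ q₁

-- Two suffixes of one a-suffix start in the same column q. Call a column clean if it is filled
-- in every row and the a-suffixes starting there are determined by their first character; every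
-- column of a cs-region and the last column of every ps-region is clean. If q lies in a
-- cs-region, or is where both rows begin their content inside the ps-region of α̃⁺_i Δ_i, the
-- two preceding characters sit in one clean column (the last column before q, resp. before the
-- ps-region, cyclically N − 1). If q is strictly inside the content of both rows, both
-- predecessors sit at q − 1 in that ps-region, and the equal δ's stay equal after prefixing σ.
-- The mixed case cannot occur: the δ of the row with q inside its content would be a proper
-- suffix of α̃⁺_i Δ^j_i beginning with α̃⁺_i, so α̃⁺_i would occur twice in S^j.

module Submission where

open import Data.Bool using (true; false; T)
open import Data.Empty using (⊥-elim)
open import Data.Fin using (Fin; inject₁) renaming (zero to fzero; suc to fsuc)
open import Data.List using (List; []; _∷_; [_]; _++_; length; replicate; map; take; drop; foldr; catMaybes; concat)
open import Data.List.Membership.Propositional using (_∈_)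
open import Data.List.Membership.Propositional.Properties using (∈-allFin)
open import Data.List.Properties
  using (++-assoc; ++-identityʳ; ++-conicalˡ; length-++; length-map; length-replicate; take++drop≡id; take-all; drop-map; catMaybes-++)
open import Data.List.Relation.Unary.Any using (here; there)
open import Data.Maybe using (Maybe; just; nothing)
open import Data.Nat
open import Data.Nat.Properties
open import Data.Product using (Σ; _×_; _,_; proj₁; proj₂)
open import Data.Sum using (inj₁; inj₂)
open import Data.Unit using (⊤; tt)
open import Data.Vec using (Vec; lookup; last; init; zipWith; tail) renaming ([] to []ᵥ; _∷_ to _∷ᵥ_)
open import Data.Vec.Properties using (lookup-zipWith; lookup∘tabulate)
open import Function using (_∘_)
open import Relation.Binary.Definitions using (tri<; tri≈; tri>)
open import Relation.Binary.PropositionalEquality hiding ([_])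
open import Relation.Nullary using (¬_; yes; no)

open import Defs

m<n+o⇒m∸n<o′ : ∀ {m n o} → n ≤ m → m < n + o → m ∸ n < o
m<n+o⇒m∸n<o′ {m} {n} {o} n≤m lt = subst (m ∸ n <_) (m+n∸m≡n n o) (∸-monoˡ-< lt n≤m)

-- Strings and rows with gaps

module _ {A : Set} where

  drop-++-length : ∀ (xs ys : List A) t → drop (length xs + t) (xs ++ ys) ≡ drop t ys
  drop-++-length []       ys t = refl
  drop-++-length (_ ∷ xs) ys t = drop-++-length xs ys t

  take-drop-++ : ∀ (xs ys : List A) t → take (length xs ∸ t) (drop t (xs ++ ys)) ≡ drop t xs
  take-drop-++ []       ys zero    = refl
  take-drop-++ []       ys (suc t) = refl
  take-drop-++ (x ∷ xs) ys zero    = cong (x ∷_) (take-drop-++ xs ys zero)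
  take-drop-++ (x ∷ xs) ys (suc t) = take-drop-++ xs ys t

  take-length-++ : (xs ys : List A) → take (length xs) (xs ++ ys) ≡ xs
  take-length-++ []       ys = refl
  take-length-++ (x ∷ xs) ys = cong (x ∷_) (take-length-++ xs ys)

  take-before-suffix : ∀ {zs} (xs ys : List A) → zs ≡ xs ++ ys → take (length zs ∸ length ys) zs ++ ys ≡ zs
  take-before-suffix xs ys refl rewrite length-++ xs {ys} | m+n∸n≡m (length xs) (length ys) | take-length-++ xs ys = refl

  ¬occursOnce-[] : ∀ {x} {xs : List A} → ¬ OccursOnce [] (x ∷ xs)
  ¬occursOnce-[] {x} {xs} (p , _ , unique) with trans (unique 0 ([] , _ , refl , refl))
                                                      (sym (unique 1 ([ x ] , xs , refl , refl)))
  ... | ()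

  occursOnce-¬reoccurs : ∀ {a d₁ d₂ : List A} pre post k → a ≢ [] →
                         drop (suc k) (a ++ d₁) ≡ a ++ d₂ → ¬ OccursOnce a (pre ++ (a ++ d₁) ++ post)
  occursOnce-¬reoccurs {[]}     pre post k a≢[] _ _ = a≢[] refl
  occursOnce-¬reoccurs {x ∷ a'} {d₁} {d₂} pre post k _ shifted (p , _ , unique) =
    m+1+n≢m (length pre) (sym (trans (unique _ atStart) (sym (unique _ atShift))))
    where
      a = x ∷ a'
      skipped = x ∷ take k (a' ++ d₁)
      atStart : OccursAt a (pre ++ (a ++ d₁) ++ post) (length pre)
      atStart = pre , d₁ ++ post , cong (pre ++_) (++-assoc a d₁ post) , refl
      split : a ++ d₁ ≡ skipped ++ a ++ d₂
      split = trans (sym (take++drop≡id (suc k) (a ++ d₁))) (cong (skipped ++_) shifted)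
      atShift : OccursAt a (pre ++ (a ++ d₁) ++ post) (length pre + suc (length (take k (a' ++ d₁))))
      atShift = pre ++ skipped , d₂ ++ post , text , length-++ pre
        where
          open ≡-Reasoning
          text : pre ++ (a ++ d₁) ++ post ≡ (pre ++ skipped) ++ a ++ d₂ ++ post
          text = begin
              pre ++ (a ++ d₁) ++ post
            ≡⟨ cong (λ s → pre ++ s ++ post) split ⟩
              pre ++ (skipped ++ a ++ d₂) ++ post
            ≡⟨ cong (pre ++_) (trans (++-assoc skipped (a ++ d₂) post) (cong (skipped ++_) (++-assoc a d₂ post))) ⟩
              pre ++ skipped ++ a ++ d₂ ++ post
            ≡⟨ sym (++-assoc pre skipped (a ++ d₂ ++ post)) ⟩
              (pre ++ skipped) ++ a ++ d₂ ++ post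
            ∎

  interleave-head : ∀ {r} (as : Vec (List A) (suc r)) ds → Σ (List A) λ t → interleave as ds ≡ lookup as fzero ++ t
  interleave-head {zero}  (a ∷ᵥ []ᵥ) []ᵥ        = [] , sym (++-identityʳ a)
  interleave-head {suc r} (a ∷ᵥ as)  (d ∷ᵥ ds) = d ++ interleave as ds , refl

module _ {A : Set} where

  catMaybes-map-just : (xs : List A) → catMaybes (map just xs) ≡ xs
  catMaybes-map-just []       = refl
  catMaybes-map-just (x ∷ xs) = cong (x ∷_) (catMaybes-map-just xs)

  catMaybes-gaps : ∀ g (ys : List (Maybe A)) → catMaybes (replicate g nothing ++ ys) ≡ catMaybes ys
  catMaybes-gaps zero    ys = refl
  catMaybes-gaps (suc g) ys = catMaybes-gaps g ys

  catMaybes-pad : ∀ w (xs : List A) → catMaybes (pad w xs) ≡ xs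
  catMaybes-pad w xs = trans (catMaybes-gaps (w ∸ length xs) (map just xs)) (catMaybes-map-just xs)

  drop-gaps : ∀ g v (ys : List (Maybe A)) → drop (g + v) (replicate g nothing ++ ys) ≡ drop v ys
  drop-gaps zero    v ys = refl
  drop-gaps (suc g) v ys = drop-gaps g v ys

  catMaybes-drop-pad : ∀ w (xs : List A) t → w ∸ length xs ≤ t →
                       catMaybes (drop t (pad w xs)) ≡ drop (t ∸ (w ∸ length xs)) xs
  catMaybes-drop-pad w xs t g≤t = begin
      catMaybes (drop t (pad w xs))
    ≡⟨ cong (λ n → catMaybes (drop n (pad w xs))) (sym (m+[n∸m]≡n g≤t)) ⟩
      catMaybes (drop (g + (t ∸ g)) (replicate g nothing ++ map just xs))
    ≡⟨ cong catMaybes (trans (drop-gaps g (t ∸ g) (map just xs)) (drop-map (t ∸ g) xs)) ⟩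
      catMaybes (map just (drop (t ∸ g) xs))
    ≡⟨ catMaybes-map-just (drop (t ∸ g) xs) ⟩
      drop (t ∸ g) xs
    ∎
    where
      open ≡-Reasoning
      g = w ∸ length xs

  length-pad : ∀ {w} (xs : List A) → length xs ≤ w → length (pad w xs) ≡ w
  length-pad {w} xs le = begin
      length (replicate (w ∸ length xs) nothing ++ map just xs)
    ≡⟨ length-++ (replicate (w ∸ length xs) nothing) ⟩
      length (replicate (w ∸ length xs) nothing) + length (map just xs)
    ≡⟨ cong₂ _+_ (length-replicate (w ∸ length xs)) (length-map just xs) ⟩
      w ∸ length xs + length xs
    ≡⟨ m∸n+n≡m le ⟩
      w
    ∎
    where open ≡-Reasoning

  cellAt-just⇒< : ∀ (xs : List (Maybe A)) q {x} → cellAt xs q ≡ just x → q < length xs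
  cellAt-just⇒< (_ ∷ xs) zero    _  = s≤s z≤n
  cellAt-just⇒< (_ ∷ xs) (suc q) eq = s≤s (cellAt-just⇒< xs q eq)

  cellAt-++ʳ : ∀ (xs ys : List (Maybe A)) u → cellAt (xs ++ ys) (length xs + u) ≡ cellAt ys u
  cellAt-++ʳ []       ys u = refl
  cellAt-++ʳ (_ ∷ xs) ys u = cellAt-++ʳ xs ys u

  cellAt-++ˡ : ∀ (xs ys : List (Maybe A)) {u} → u < length xs → cellAt (xs ++ ys) u ≡ cellAt xs u
  cellAt-++ˡ (_ ∷ xs) ys {zero}  _        = refl
  cellAt-++ˡ (_ ∷ xs) ys {suc u} (s≤s lt) = cellAt-++ˡ xs ys lt

  cellAt-gaps : ∀ g (ys : List (Maybe A)) {u} → u < g → cellAt (replicate g nothing ++ ys) u ≡ nothing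
  cellAt-gaps (suc g) ys {zero}  _        = refl
  cellAt-gaps (suc g) ys {suc u} (s≤s lt) = cellAt-gaps g ys lt

  cellAt-gaps-after : ∀ g (ys : List (Maybe A)) v → cellAt (replicate g nothing ++ ys) (g + v) ≡ cellAt ys v
  cellAt-gaps-after zero    ys v = refl
  cellAt-gaps-after (suc g) ys v = cellAt-gaps-after g ys v

  cellAt-map-just : ∀ (xs : List A) {v} → v < length xs → Σ A λ x → cellAt (map just xs) v ≡ just x
  cellAt-map-just (x ∷ xs) {zero}  _        = x , refl
  cellAt-map-just (x ∷ xs) {suc v} (s≤s lt) = cellAt-map-just xs lt

  cellAt-pad-char : ∀ w (xs : List A) {u} → length xs ≤ w → w ∸ length xs ≤ u → u < w →
                    Σ A λ x → cellAt (pad w xs) u ≡ just x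
  cellAt-pad-char w xs {u} fits g≤u u<w =
    subst (λ n → Σ A λ x → cellAt (pad w xs) n ≡ just x) (m+[n∸m]≡n g≤u) char
    where
      g = w ∸ length xs
      char : Σ A λ x → cellAt (pad w xs) (g + (u ∸ g)) ≡ just x
      char with cellAt-map-just xs (m<n+o⇒m∸n<o′ g≤u (subst (u <_) (sym (m∸n+n≡m fits)) u<w))
      ... | x , eq = x , trans (cellAt-gaps-after g (map just xs) (u ∸ g)) eq

  pad-last-char : ∀ {w} (xs : List A) → xs ≢ [] → length xs ≤ suc w →
                  Σ A λ x → cellAt (pad (suc w) xs) w ≡ just x
  pad-last-char []       xs≢[] _    = ⊥-elim (xs≢[] refl)
  pad-last-char {w} (y ∷ ys) _     fits = cellAt-pad-char (suc w) (y ∷ ys) fits (m∸n≤m w (length ys)) ≤-refl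

  window : List (Maybe A) → ℕ → ℕ → List A
  window xs c e = catMaybes (take (e ∸ c) (drop c xs))

  drop-cell : ∀ (xs : List (Maybe A)) c {x} → cellAt xs c ≡ just x → drop c xs ≡ just x ∷ drop (suc c) xs
  drop-cell (_ ∷ xs) zero    eq = cong (_∷ xs) eq
  drop-cell (_ ∷ xs) (suc c) eq = drop-cell xs c eq

  window-cons : ∀ (xs : List (Maybe A)) c e {x} → cellAt xs c ≡ just x → c < e →
                window xs c e ≡ x ∷ window xs (suc c) e
  window-cons xs c (suc e) eq (s≤s c≤e) rewrite +-∸-assoc 1 c≤e | drop-cell xs c eq = refl

  window-empty : ∀ (xs : List (Maybe A)) c → window xs c c ≡ []
  window-empty xs c rewrite n∸n≡0 c = refl

  window-middle : ∀ (xs ys zs : List (Maybe A)) t →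
                  window (xs ++ ys ++ zs) (length xs + t) (length xs + length ys) ≡ catMaybes (drop t ys)
  window-middle xs ys zs t = begin
      catMaybes (take (length xs + length ys ∸ (length xs + t)) (drop (length xs + t) (xs ++ ys ++ zs)))
    ≡⟨ cong₂ (λ n l → catMaybes (take n l)) ([m+n]∸[m+o]≡n∸o (length xs) (length ys) t)
             (drop-++-length xs (ys ++ zs) t) ⟩
      catMaybes (take (length ys ∸ t) (drop t (ys ++ zs)))
    ≡⟨ cong catMaybes (take-drop-++ ys zs t) ⟩
      catMaybes (drop t ys)
    ∎
    where open ≡-Reasoning

  catMaybes-rowBlocks : ∀ {k} (D A⁺ As : Vec (List A) (suc k)) (C Ds : Vec (List A) k) (W : Vec ℕ k) →
    (∀ i → lookup C i ≡ lookup A⁺ (inject₁ i) ++ lookup Ds i) →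
    (∀ i → lookup D (inject₁ i) ++ lookup A⁺ (inject₁ i) ≡ lookup As (inject₁ i)) →
    last D ≡ last As →
    catMaybes (concat (map proj₂ (rowBlocks D C W))) ≡ interleave As Ds
  catMaybes-rowBlocks (d ∷ᵥ []ᵥ) _ (a ∷ᵥ []ᵥ) []ᵥ []ᵥ []ᵥ _ _ lastEq = begin
      catMaybes (map just d ++ [])   ≡⟨ cong catMaybes (++-identityʳ (map just d)) ⟩
      catMaybes (map just d)         ≡⟨ catMaybes-map-just d ⟩
      d                              ≡⟨ lastEq ⟩
      a                              ∎
    where open ≡-Reasoning
  catMaybes-rowBlocks {suc k} (d ∷ᵥ D) (p ∷ᵥ A⁺) (a ∷ᵥ As) (c ∷ᵥ C) (δ ∷ᵥ Ds) (w ∷ᵥ W)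
                      contents split lastEq = begin
      catMaybes (map just d ++ pad w c ++ rest)
    ≡⟨ catMaybes-++ (map just d) (pad w c ++ rest) ⟩
      catMaybes (map just d) ++ catMaybes (pad w c ++ rest)
    ≡⟨ cong₂ _++_ (catMaybes-map-just d) (catMaybes-++ (pad w c) rest) ⟩
      d ++ catMaybes (pad w c) ++ catMaybes rest
    ≡⟨ cong₂ (λ u v → d ++ u ++ v) (trans (catMaybes-pad w c) (contents fzero))
             (catMaybes-rowBlocks D A⁺ As C Ds W (contents ∘ fsuc) (split ∘ fsuc) lastEq) ⟩
      d ++ (p ++ δ) ++ interleave As Ds
    ≡⟨ cong (d ++_) (++-assoc p δ _) ⟩
      d ++ p ++ δ ++ interleave As Ds
    ≡⟨ sym (++-assoc d p _) ⟩
      (d ++ p) ++ δ ++ interleave As Ds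
    ≡⟨ cong (_++ (δ ++ interleave As Ds)) (split fzero) ⟩
      a ++ δ ++ interleave As Ds
    ∎
    where
      open ≡-Reasoning
      rest = concat (map proj₂ (rowBlocks D C W))

module _ {A : Set} where

  lookup-init : ∀ {n} (v : Vec A (suc n)) (i : Fin n) → lookup (init v) i ≡ lookup v (inject₁ i)
  lookup-init (x ∷ᵥ y ∷ᵥ v) fzero    = refl
  lookup-init (x ∷ᵥ y ∷ᵥ v) (fsuc i) = lookup-init (y ∷ᵥ v) i

  last-zipWith : ∀ {B C : Set} (f : A → B → C) {n} (xs : Vec A (suc n)) ys →
                 last (zipWith f xs ys) ≡ f (last xs) (last ys)
  last-zipWith f (x ∷ᵥ []ᵥ)      (y ∷ᵥ []ᵥ)      = refl
  last-zipWith f (x ∷ᵥ x' ∷ᵥ xs) (y ∷ᵥ y' ∷ᵥ ys) = last-zipWith f (x' ∷ᵥ xs) (y' ∷ᵥ ys)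

  []-unique : (v : Vec A 0) → v ≡ []ᵥ
  []-unique []ᵥ = refl

  ∷-η : ∀ {n} (v : Vec A (suc n)) → v ≡ lookup v fzero ∷ᵥ tail v
  ∷-η (x ∷ᵥ v) = refl

  lookup-tail : ∀ {n} (v : Vec A (suc n)) i → lookup (tail v) i ≡ lookup v (fsuc i)
  lookup-tail (x ∷ᵥ v) i = refl

  ≤-foldr-⊔ : (f : A → ℕ) {xs : List A} {x : A} → x ∈ xs → f x ≤ foldr _⊔_ 0 (map f xs)
  ≤-foldr-⊔ f {y ∷ _} (here refl) = m≤m⊔n (f y) _
  ≤-foldr-⊔ f {y ∷ _} (there x∈) = ≤-trans (≤-foldr-⊔ f x∈) (m≤n⊔m (f y) _)

totalWidth : List (Kind × ℕ) → ℕ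
totalWidth bs = foldr (λ b n → proj₂ b + n) 0 bs

regionFrom-here : ∀ off k w bs {q} → q < off + w → regionFrom off ((k , w) ∷ bs) q ≡ just (k , off + w)
regionFrom-here off k w bs {q} lt with q <ᵇ off + w in eq
... | true  = refl
... | false = ⊥-elim (subst T eq (<⇒<ᵇ lt))

regionFrom-there : ∀ off k w bs {q} → off + w ≤ q → regionFrom off ((k , w) ∷ bs) q ≡ regionFrom (off + w) bs q
regionFrom-there off k w bs {q} le with q <ᵇ off + w in eq
... | true  = ⊥-elim (≤⇒≯ le (<ᵇ⇒< q (off + w) (subst T (sym eq) _)))
... | false = refl

module AlignmentFacts (I : Input) (wf : WellFormed I) where
  open Input I
  open WellFormed wf
  open Alignment I

  Gaps : Fin m → ℕ → ℕ → Set
  Gaps j s q = ∀ c → s ≤ c → c < q → cell j c ≡ nothing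

  no-gaps : ∀ {j q} → Gaps j q q
  no-gaps _ q≤c c<q = ⊥-elim (<⇒≱ c<q q≤c)

  nonempty≢nothing : ∀ {j x} → Nonempty j x → cell j x ≢ nothing
  nonempty≢nothing (_ , eq) eq' with trans (sym eq) eq'
  ... | ()

  CharDetermined : ℕ → Set
  CharDetermined o = ∀ j₁ j₂ {σ} → cell j₁ o ≡ just σ → cell j₂ o ≡ just σ →
    sameRule (region o) j₁ j₂ o

  -- For q = 0 nothing is required: the cyclic predecessor N ∸ 1 is covered by charDetermined-last.
  CommonPredecessor : ℕ → Set
  CommonPredecessor zero    = ⊤
  CommonPredecessor (suc o) = (∀ j → Nonempty j o) × CharDetermined o

  charDetermined-cs : ∀ {o e} → region o ≡ just (csR , e) → CharDetermined o
  charDetermined-cs eq _ _ _ _ rewrite eq = tt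

  δ-single : ∀ j o {σ} → cell j o ≡ just σ → δ j o (suc o) ≡ σ ∷ []
  δ-single j o c = trans (window-cons (row j) o (suc o) c (n<1+n o)) (cong (_ ∷_) (window-empty (row j) (suc o)))

  charDetermined-psEnd : ∀ {o} → region o ≡ just (psR , suc o) → CharDetermined o
  charDetermined-psEnd {o} eq j₁ j₂ c₁ c₂ rewrite eq = trans (δ-single j₁ o c₁) (sym (δ-single j₂ o c₂))

  sameRule-euclidean : ∀ r {j₀ j₁ j₂ q} → sameRule r j₀ j₁ q → sameRule r j₀ j₂ q → sameRule r j₁ j₂ q
  sameRule-euclidean (just (csR , _)) _  _  = tt
  sameRule-euclidean (just (psR , _)) s₁ s₂ = trans (sym s₁) s₂

  lookup-psContent : ∀ j i → lookup (psContent j) i ≡ lookup αplus (inject₁ i) ++ lookup (Δ j) i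
  lookup-psContent j i = trans (lookup-zipWith _++_ i (init αplus) (Δ j)) (cong (_++ lookup (Δ j) i) (lookup-init αplus i))

  catMaybes-row : ∀ j → catMaybes (row j) ≡ S j
  catMaybes-row j = catMaybes-rowBlocks diamonds αplus α (psContent j) (Δ j) widths (lookup-psContent j) split lastEq
    where
      split : ∀ i → lookup diamonds (inject₁ i) ++ lookup αplus (inject₁ i) ≡ lookup α (inject₁ i)
      split i with plus-suffix i
      ... | pre , eq = trans (cong (_++ lookup αplus (inject₁ i)) (lookup-zipWith _ (inject₁ i) α αplus))
                             (take-before-suffix pre (lookup αplus (inject₁ i)) eq)
      lastEq : last diamonds ≡ last α
      lastEq = trans (last-zipWith _ α αplus)
                 (trans (cong (λ p → take (length (last α) ∸ length p) (last α)) plus-last)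
                        (take-all (length (last α)) (last α) ≤-refl))

  anchor≢[] : ∀ {a} j → OccursOnce a (S j) → a ≢ []
  anchor≢[] j once refl with interleave-head α (Δ j) | α₁-starts-$
  ... | t , S≡ | t' , α₁≡ = ¬occursOnce-[] (subst (OccursOnce []) (trans S≡ (cong (_++ t) α₁≡)) once)

  cell-in-block : ∀ j P X R → row j ≡ P ++ X ++ R → ∀ {u} → u < length X → cell j (length P + u) ≡ cellAt X u
  cell-in-block j P X R eq {u} lt =
    trans (cong (λ xs → cellAt xs (length P + u)) eq) (trans (cellAt-++ʳ P (X ++ R) u) (cellAt-++ˡ X R lt))

  block-offset : ∀ {off o} (P : List (Maybe Char)) → length P ≡ off → off ≤ o → o ≡ length P + (o ∸ off)
  block-offset P refl le = sym (m+[n∸m]≡n le)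

  -- The block layout of the transformed alignment

  record RegionsFrom (off : ℕ) (bs : List (Kind × ℕ)) : Set where
    constructor regionsFrom
    field region≡ : ∀ q → off ≤ q → region q ≡ regionFrom off bs q

  regionsFrom-head : ∀ {off k w bs} → RegionsFrom off ((k , w) ∷ bs) →
                     ∀ o → off ≤ o → o < off + w → region o ≡ just (k , off + w)
  regionsFrom-head {off} {k} {w} {bs} (regionsFrom regions) o le lt = trans (regions o le) (regionFrom-here off k w bs lt)

  regionsFrom-tail : ∀ {off k w bs} → RegionsFrom off ((k , w) ∷ bs) → RegionsFrom (off + w) bs
  regionsFrom-tail {off} {k} {w} {bs} (regionsFrom regions) = regionsFrom λ q le →
    trans (regions q (≤-trans (m≤m+n off w) le)) (regionFrom-there off k w bs le)

  -- The ps-region [start, end) of α̃⁺_i Δ_i: anchor is α̃⁺_i and tails j is Δ^j_i.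
  record PsBlock (start end : ℕ) : Set where
    field
      width       : ℕ
      anchor      : List Char
      tails       : Fin m → List Char
      left right  : Fin m → List (Maybe Char)
      row-split   : ∀ j → row j ≡ left j ++ pad width (anchor ++ tails j) ++ right j
      length-left : ∀ j → length (left j) ≡ start
      end≡        : end ≡ start + width
      region-ps   : ∀ c → start ≤ c → c < end → region c ≡ just (psR , end)
      anchor-once : ∀ j → OccursOnce anchor (S j)
      fits        : ∀ j → length (anchor ++ tails j) ≤ width
      before      : CommonPredecessor start

  ColumnFacts : ℕ → Maybe (Kind × ℕ) → Set
  ColumnFacts q nothing          = ⊤
  ColumnFacts q (just (csR , _)) = CommonPredecessor q
  ColumnFacts q (just (psR , e)) = Σ ℕ λ start → PsBlock start e × start ≤ q × q < e

  record LayoutFrom (off total : ℕ) : Set where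
    field
      column     : ∀ q → off ≤ q → ColumnFacts q (region q)
      end        : CommonPredecessor (off + total)
      row-length : ∀ j → length (row j) ≡ off + total

  module _ {off bs} (d : List Char) (P R : Fin m → List (Maybe Char))
           (length-P : ∀ j → length (P j) ≡ off) (row-eq : ∀ j → row j ≡ P j ++ map just d ++ R j)
           (regions : RegionsFrom off ((csR , length d) ∷ bs)) (before : CommonPredecessor off) where

    commonPredecessor-cs : ∀ q → off ≤ q → q ≤ off + length d → CommonPredecessor q
    commonPredecessor-cs q off≤q q≤end with m≤n⇒m<n∨m≡n off≤q
    ... | inj₂ refl = before
    commonPredecessor-cs (suc o) _ o<end | inj₁ (s≤s off≤o) =
      filled , charDetermined-cs (regionsFrom-head regions o off≤o o<end)
      where
        u<d : o ∸ off < length d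
        u<d = m<n+o⇒m∸n<o′ off≤o o<end
        filled : ∀ j → Nonempty j o
        filled j with cellAt-map-just d u<d
        ... | x , eq = x , trans (cong (cell j) (block-offset (P j) (length-P j) off≤o))
                            (trans (cell-in-block j (P j) (map just d) (R j) (row-eq j)
                                      (subst (_ <_) (sym (length-map just d)) u<d)) eq)

    columnFacts-cs : ∀ q → off ≤ q → q < off + length d → ColumnFacts q (region q)
    columnFacts-cs q le lt =
      subst (ColumnFacts q) (sym (regionsFrom-head regions q le lt)) (commonPredecessor-cs q le (<⇒≤ lt))

  commonPredecessor-psEnd : ∀ {start end} → PsBlock start end → CommonPredecessor end
  commonPredecessor-psEnd {start} {end} block = subst CommonPredecessor (sym end≡) (upTo width refl)
    where
      open PsBlock block
      upTo : ∀ w → w ≡ width → CommonPredecessor (start + w)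
      upTo zero    _  = subst CommonPredecessor (sym (+-identityʳ start)) before
      upTo (suc w) w≡ = subst CommonPredecessor (sym (+-suc start w)) (filled , charDetermined-psEnd region-last)
        where
          end≡′ : end ≡ suc (start + w)
          end≡′ = trans end≡ (trans (cong (start +_) (sym w≡)) (+-suc start w))
          region-last : region (start + w) ≡ just (psR , suc (start + w))
          region-last = trans (region-ps (start + w) (m≤m+n start w) (subst (start + w <_) (sym end≡′) ≤-refl))
                              (cong (λ e → just (psR , e)) end≡′)
          filled : ∀ j → Nonempty j (start + w)
          filled j with pad-last-char (anchor ++ tails j) (anchor≢[] j (anchor-once j) ∘ ++-conicalˡ anchor (tails j))
                                      (subst (length (anchor ++ tails j) ≤_) (sym w≡) (fits j))
          ... | x , eq = x , trans (cong (λ n → cell j (n + w)) (sym (length-left j)))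
                              (trans (cell-in-block j (left j) (pad width (anchor ++ tails j)) (right j) (row-split j)
                                        (subst (w <_) (trans w≡ (sym (length-pad (anchor ++ tails j) (fits j)))) ≤-refl))
                                     (subst (λ n → cellAt (pad n (anchor ++ tails j)) w ≡ just x) w≡ eq))

  AnchoredContents : ∀ {k} → (Fin m → Vec (List Char) k) → Set
  AnchoredContents {k} C = ∀ (i : Fin k) → Σ (List Char) λ a →
    (∀ j → OccursOnce a (S j)) × (∀ j → Σ (List Char) λ d → lookup (C j) i ≡ a ++ d)

  FitIn : ∀ {k} → (Fin m → Vec (List Char) k) → Vec ℕ k → Set
  FitIn {k} C W = ∀ (i : Fin k) j → length (lookup (C j) i) ≤ lookup W i

  anchoredContents-tail : ∀ {k} (C : Fin m → Vec (List Char) (suc k)) →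
                          AnchoredContents C → AnchoredContents (tail ∘ C)
  anchoredContents-tail C anchored i with anchored (fsuc i)
  ... | a , once , heads = a , once , λ j → proj₁ (heads j) , trans (lookup-tail (C j) i) (proj₂ (heads j))

  fitIn-tail : ∀ {k} (C : Fin m → Vec (List Char) (suc k)) {w W} → FitIn C (w ∷ᵥ W) → FitIn (tail ∘ C) W
  fitIn-tail C {W = W} fit i j = subst (λ c → length c ≤ lookup W i) (sym (lookup-tail (C j) i)) (fit (fsuc i) j)

  layoutFrom : ∀ {k} (D : Vec (List Char) (suc k)) (W : Vec ℕ k) (C : Fin m → Vec (List Char) k) →
    AnchoredContents C → FitIn C W → ∀ {off} (P : Fin m → List (Maybe Char)) →
    (∀ j → length (P j) ≡ off) → (∀ j → row j ≡ P j ++ concat (map proj₂ (rowBlocks D (C j) W))) →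
    RegionsFrom off (layout D W) → CommonPredecessor off → LayoutFrom off (totalWidth (layout D W))
  layoutFrom {zero} (d ∷ᵥ []ᵥ) []ᵥ C _ _ {off} P length-P row-eq regions before = record
    { column     = column
    ; end        = subst (λ n → CommonPredecessor (off + n)) (sym (+-identityʳ (length d)))
                     (commonPredecessor-cs d P (λ _ → []) length-P row-eq′ regions before _ (m≤m+n off _) ≤-refl)
    ; row-length = λ j → trans (cong length (row-eq′ j))
                     (trans (length-++ (P j)) (cong₂ _+_ (length-P j)
                       (trans (length-++ (map just d)) (cong (_+ 0) (length-map just d)))))
    }
    where
      row-eq′ : ∀ j → row j ≡ P j ++ map just d ++ []
      row-eq′ j = trans (row-eq j)
        (cong (λ v → P j ++ concat (map proj₂ (rowBlocks (d ∷ᵥ []ᵥ) v []ᵥ))) ([]-unique (C j)))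
      column : ∀ q → off ≤ q → ColumnFacts q (region q)
      column q le with q <? off + length d
      ... | yes lt = columnFacts-cs d P (λ _ → []) length-P row-eq′ regions before q le lt
      ... | no ≮  = subst (ColumnFacts q) (sym (RegionsFrom.region≡ (regionsFrom-tail regions) q (≮⇒≥ ≮))) tt
  layoutFrom {suc k} (d ∷ᵥ D) (w ∷ᵥ W) C anchored fit {off} P length-P row-eq regions before
    with anchored fzero
  ... | a , once , heads = record
    { column     = column
    ; end        = subst CommonPredecessor assoc (LayoutFrom.end rest-facts)
    ; row-length = λ j → trans (LayoutFrom.row-length rest-facts j) assoc
    }
    where
      off₁ = off + length d
      off₂ = off₁ + w
      tails : Fin m → List Char
      tails j = proj₁ (heads j)
      rest : Fin m → List (Maybe Char)
      rest j = concat (map proj₂ (rowBlocks D (tail (C j)) W))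
      fits : ∀ j → length (a ++ tails j) ≤ w
      fits j = subst (λ c → length c ≤ w) (proj₂ (heads j)) (fit fzero j)
      row-eq₀ : ∀ j → row j ≡ P j ++ map just d ++ pad w (a ++ tails j) ++ rest j
      row-eq₀ j = trans (row-eq j)
        (trans (cong (λ v → P j ++ concat (map proj₂ (rowBlocks (d ∷ᵥ D) v (w ∷ᵥ W)))) (∷-η (C j)))
               (cong (λ c → P j ++ map just d ++ pad w c ++ rest j) (proj₂ (heads j))))
      cs-end : CommonPredecessor off₁
      cs-end = commonPredecessor-cs d P _ length-P row-eq₀ regions before off₁ (m≤m+n off _) ≤-refl
      ps-block : PsBlock off₁ off₂
      ps-block = record
        { width = w ; anchor = a ; tails = tails ; left = λ j → P j ++ map just d ; right = rest
        ; row-split   = λ j → trans (row-eq₀ j) (sym (++-assoc (P j) (map just d) _))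
        ; length-left = λ j → trans (length-++ (P j)) (cong₂ _+_ (length-P j) (length-map just d))
        ; end≡ = refl ; region-ps = regionsFrom-head (regionsFrom-tail regions)
        ; anchor-once = once ; fits = fits ; before = cs-end }
      open PsBlock ps-block using (left; row-split; length-left)
      rest-facts : LayoutFrom off₂ (totalWidth (layout D W))
      rest-facts = layoutFrom D W (tail ∘ C) (anchoredContents-tail C anchored) (fitIn-tail C fit)
        (λ j → left j ++ pad w (a ++ tails j))
        (λ j → trans (length-++ (left j)) (cong₂ _+_ (length-left j) (length-pad (a ++ tails j) (fits j))))
        (λ j → trans (row-split j) (sym (++-assoc (left j) (pad w (a ++ tails j)) (rest j))))
        (regionsFrom-tail (regionsFrom-tail regions)) (commonPredecessor-psEnd ps-block)
      column : ∀ q → off ≤ q → ColumnFacts q (region q)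
      column q le with q <? off₁
      ... | yes lt = columnFacts-cs d P _ length-P row-eq₀ regions before q le lt
      ... | no ≮₁ with q <? off₂
      ...   | yes lt = subst (ColumnFacts q) (sym (PsBlock.region-ps ps-block q (≮⇒≥ ≮₁) lt))
                             (off₁ , ps-block , ≮⇒≥ ≮₁ , lt)
      ...   | no ≮₂  = LayoutFrom.column rest-facts q (≮⇒≥ ≮₂)
      assoc : off₂ + totalWidth (layout D W) ≡ off + (length d + (w + totalWidth (layout D W)))
      assoc = trans (+-assoc off₁ w _) (+-assoc off (length d) _)

  layoutFacts : LayoutFrom 0 N
  layoutFacts = layoutFrom diamonds widths psContent anchored fits
                  (λ _ → []) (λ _ → refl) (λ _ → refl) (regionsFrom λ _ _ → refl) tt
    where
      anchored : AnchoredContents psContent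
      anchored i = lookup αplus (inject₁ i) , plus-once i , λ j → lookup (Δ j) i , lookup-psContent j i
      fits : FitIn psContent widths
      fits i j = subst (length (lookup (psContent j) i) ≤_) (sym (lookup∘tabulate _ i))
                   (≤-foldr-⊔ (λ j → length (lookup (psContent j) i)) (∈-allFin j))

  -- Preceding characters

  charDetermined-last : CharDetermined (N ∸ 1)
  charDetermined-last = lastColumn N (LayoutFrom.end layoutFacts) (LayoutFrom.row-length layoutFacts)
    where
      lastColumn : ∀ n → CommonPredecessor n → (∀ j → length (row j) ≡ n) → CharDetermined (n ∸ 1)
      lastColumn zero    _             len j₁ _ c₁ _ =
        ⊥-elim (n≮0 (subst (0 <_) (len j₁) (cellAt-just⇒< (row j₁) 0 c₁)))
      lastColumn (suc o) (_ , charDet) _ = charDet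

  predecessorColumn : ℕ → ℕ
  predecessorColumn zero    = N ∸ 1
  predecessorColumn (suc o) = o

  charDetermined-predecessor : ∀ {s} → CommonPredecessor s → CharDetermined (predecessorColumn s)
  charDetermined-predecessor {zero}  _             = charDetermined-last
  charDetermined-predecessor {suc o} (_ , charDet) = charDet

  IsPrev-suc : ∀ {j x} → Nonempty j x → IsPrev j (suc x) x
  IsPrev-suc ne = inj₁ (n<1+n _ , ne , λ _ x<c c<sx → ⊥-elim (<⇒≱ x<c (≤-pred c<sx)))

  IsPrev-commonPredecessor : ∀ {s q j} → CommonPredecessor s → s ≤ q → Gaps j s q → IsPrev j q (predecessorColumn s)
  IsPrev-commonPredecessor {zero}      _         _   gaps = inj₂ ((λ c c<q → gaps c z≤n c<q) , refl)
  IsPrev-commonPredecessor {suc o} {j = j} (filled , _) s≤q gaps = inj₁ (s≤q , filled j , gaps)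

  IsPrev-functional : ∀ {j q y₁ y₂} → IsPrev j q y₁ → IsPrev j q y₂ → y₁ ≡ y₂
  IsPrev-functional {y₁ = y₁} {y₂} (inj₁ (y₁<q , ne₁ , gaps₁)) (inj₁ (y₂<q , ne₂ , gaps₂))
    with <-cmp y₁ y₂
  ... | tri< y₁<y₂ _ _ = ⊥-elim (nonempty≢nothing ne₂ (gaps₁ y₂ y₁<y₂ y₂<q))
  ... | tri≈ _ y₁≡y₂ _ = y₁≡y₂
  ... | tri> _ _ y₂<y₁ = ⊥-elim (nonempty≢nothing ne₁ (gaps₂ y₁ y₂<y₁ y₁<q))
  IsPrev-functional (inj₁ (y₁<q , ne₁ , _)) (inj₂ (empty , _)) = ⊥-elim (nonempty≢nothing ne₁ (empty _ y₁<q))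
  IsPrev-functional (inj₂ (empty , _)) (inj₁ (y₂<q , ne₂ , _)) = ⊥-elim (nonempty≢nothing ne₂ (empty _ y₂<q))
  IsPrev-functional (inj₂ (_ , y₁≡)) (inj₂ (_ , y₂≡)) = trans y₁≡ (sym y₂≡)

  PredecessorsAgree : ℕ → Fin m → Fin m → Set
  PredecessorsAgree q j₁ j₂ = ∀ {y₁ y₂ σ} → IsPrev j₁ q y₁ → IsPrev j₂ q y₂ →
    cell j₁ y₁ ≡ just σ → cell j₂ y₂ ≡ just σ → y₁ ≡ y₂ × sameRule (region y₁) j₁ j₂ y₁

  predecessorsAgree-common : ∀ {s q j₁ j₂} → CommonPredecessor s → s ≤ q → Gaps j₁ s q → Gaps j₂ s q →
                             PredecessorsAgree q j₁ j₂
  predecessorsAgree-common {j₁ = j₁} {j₂} cp s≤q gaps₁ gaps₂ prev₁ prev₂ c₁ c₂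
    with IsPrev-functional prev₁ (IsPrev-commonPredecessor cp s≤q gaps₁)
       | IsPrev-functional prev₂ (IsPrev-commonPredecessor cp s≤q gaps₂)
  ... | refl | refl = refl , charDetermined-predecessor cp j₁ j₂ c₁ c₂

  module PsColumn {start q e} (block : PsBlock start e) (start≤q : start ≤ q) (q<e : q < e) where
    open PsBlock block

    data Position (j : Fin m) : Set where
      first : Gaps j start q → δ j q e ≡ anchor ++ tails j → Position j
      inner : ∀ {x} k → q ≡ suc x → start ≤ x → Nonempty j x →
              δ j q e ≡ drop (suc k) (anchor ++ tails j) → Position j

    module InRow (j : Fin m) where
      content = anchor ++ tails j
      gap     = width ∸ length content
      offset  = q ∸ start

      q≡ : q ≡ length (left j) + offset
      q≡ = block-offset (left j) (length-left j) start≤q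

      offset<width : offset < width
      offset<width = m<n+o⇒m∸n<o′ start≤q (subst (q <_) end≡ q<e)

      cell-at : ∀ {u} → u < width → cell j (length (left j) + u) ≡ cellAt (pad width content) u
      cell-at u<w = cell-in-block j (left j) (pad width content) (right j) (row-split j)
                      (subst (_ <_) (sym (length-pad content (fits j))) u<w)

      δ-from : ∀ v → offset ≡ gap + v → δ j q e ≡ drop v content
      δ-from v offset≡ = begin
          δ j q e
        ≡⟨ cong₂ (δ j) q≡ (trans end≡ (cong₂ _+_ (sym (length-left j)) (sym (length-pad content (fits j))))) ⟩
          window (row j) (length (left j) + offset) (length (left j) + length (pad width content))
        ≡⟨ cong (λ xs → window xs (length (left j) + offset) (length (left j) + length (pad width content)))
                (row-split j) ⟩
          window (left j ++ pad width content ++ right j) (length (left j) + offset)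
                 (length (left j) + length (pad width content))
        ≡⟨ window-middle (left j) (pad width content) (right j) offset ⟩
          catMaybes (drop offset (pad width content))
        ≡⟨ catMaybes-drop-pad width content offset (subst (gap ≤_) (sym offset≡) (m≤m+n gap v)) ⟩
          drop (offset ∸ gap) content
        ≡⟨ cong (λ n → drop n content) (trans (cong (_∸ gap) offset≡) (m+n∸m≡n gap v)) ⟩
          drop v content
        ∎
        where open ≡-Reasoning

    positionAt : ∀ j v → InRow.offset j ≡ InRow.gap j + v → Position j
    positionAt j zero offset≡ = first gaps (δ-from 0 offset≡)
      where
        open InRow j
        gaps : Gaps j start q
        gaps c start≤c c<q = trans (cong (cell j) (block-offset (left j) (length-left j) start≤c))
          (trans (cell-at (<-trans u<offset offset<width))
                 (cellAt-gaps gap (map just content) (subst (c ∸ start <_) (trans offset≡ (+-identityʳ gap)) u<offset)))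
          where
            u<offset : c ∸ start < offset
            u<offset = ∸-monoˡ-< c<q start≤c
    positionAt j (suc k) offset≡ =
      inner k q≡suc (m≤m+n start _) (x , trans (cong (cell j) (cong (_+ (gap + k)) (sym (length-left j))))
                                               (trans (cell-at gap+k<width) char))
            (δ-from (suc k) offset≡)
      where
        open InRow j
        gap+k<width : gap + k < width
        gap+k<width = <-trans (+-monoʳ-< gap (n<1+n k)) (subst (_< width) offset≡ offset<width)
        x = proj₁ (cellAt-pad-char width content (fits j) (m≤m+n gap k) gap+k<width)
        char = proj₂ (cellAt-pad-char width content (fits j) (m≤m+n gap k) gap+k<width)
        q≡suc : q ≡ suc (start + (gap + k))
        q≡suc = begin
            q                           ≡⟨ sym (m+[n∸m]≡n start≤q) ⟩
            start + offset              ≡⟨ cong (start +_) (trans offset≡ (+-suc gap k)) ⟩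
            start + suc (gap + k)       ≡⟨ +-suc start (gap + k) ⟩
            suc (start + (gap + k))     ∎
          where open ≡-Reasoning

    position : ∀ j → Nonempty j q → Position j
    position j ne with InRow.offset j <? InRow.gap j
    ... | yes offset<gap = ⊥-elim (nonempty≢nothing ne (trans (cong (cell j) q≡)
                             (trans (cell-at offset<width) (cellAt-gaps gap (map just content) offset<gap))))
      where open InRow j
    ... | no ≮ = positionAt j (InRow.offset j ∸ InRow.gap j) (sym (m+[n∸m]≡n (≮⇒≥ ≮)))

    string-split : ∀ j → S j ≡ catMaybes (left j) ++ (anchor ++ tails j) ++ catMaybes (right j)
    string-split j = begin
        S j
      ≡⟨ sym (catMaybes-row j) ⟩
        catMaybes (row j)
      ≡⟨ cong catMaybes (row-split j) ⟩
        catMaybes (left j ++ pad width (anchor ++ tails j) ++ right j)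
      ≡⟨ catMaybes-++ (left j) _ ⟩
        catMaybes (left j) ++ catMaybes (pad width (anchor ++ tails j) ++ right j)
      ≡⟨ cong (catMaybes (left j) ++_) (catMaybes-++ (pad width (anchor ++ tails j)) (right j)) ⟩
        catMaybes (left j) ++ catMaybes (pad width (anchor ++ tails j)) ++ catMaybes (right j)
      ≡⟨ cong (λ c → catMaybes (left j) ++ c ++ catMaybes (right j)) (catMaybes-pad width _) ⟩
        catMaybes (left j) ++ (anchor ++ tails j) ++ catMaybes (right j)
      ∎
      where open ≡-Reasoning

    -- Equal δ's would make the anchor reappear strictly inside α̃⁺_i Δ^{j₁}_i.
    first≢inner : ∀ {j₁ j₂} k → δ j₁ q e ≡ drop (suc k) (anchor ++ tails j₁) →
                  δ j₂ q e ≡ anchor ++ tails j₂ →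
                  δ j₁ q e ≢ δ j₂ q e
    first≢inner {j₁} k δ₁≡ δ₂≡ same =
      occursOnce-¬reoccurs (catMaybes (left j₁)) (catMaybes (right j₁)) k (anchor≢[] j₁ (anchor-once j₁))
        (trans (sym δ₁≡) (trans same δ₂≡)) (subst (OccursOnce anchor) (string-split j₁) (anchor-once j₁))

    predecessorsAgree-inner : ∀ {j₁ j₂ x} → q ≡ suc x → start ≤ x → Nonempty j₁ x → Nonempty j₂ x →
                              δ j₁ q e ≡ δ j₂ q e → PredecessorsAgree q j₁ j₂
    predecessorsAgree-inner {j₁} {j₂} {x} q≡suc start≤x ne₁ ne₂ same prev₁ prev₂ c₁ c₂
      with IsPrev-functional prev₁ (subst (λ p → IsPrev j₁ p x) (sym q≡suc) (IsPrev-suc ne₁))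
         | IsPrev-functional prev₂ (subst (λ p → IsPrev j₂ p x) (sym q≡suc) (IsPrev-suc ne₂))
    ... | refl | refl = refl , subst (λ r → sameRule r j₁ j₂ x) (sym (region-ps x start≤x x<e)) δ-at-x
      where
        x<e : x < e
        x<e = subst (_≤ e) q≡suc (<⇒≤ q<e)
        same′ : δ j₁ (suc x) e ≡ δ j₂ (suc x) e
        same′ = subst (λ p → δ j₁ p e ≡ δ j₂ p e) q≡suc same
        δ-at-x : δ j₁ x e ≡ δ j₂ x e
        δ-at-x = trans (window-cons (row j₁) x e c₁ x<e)
                   (trans (cong (_ ∷_) same′) (sym (window-cons (row j₂) x e c₂ x<e)))

    predecessorsAgree-ps : ∀ {j₁ j₂} → Nonempty j₁ q → Nonempty j₂ q → δ j₁ q e ≡ δ j₂ q e →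
                           PredecessorsAgree q j₁ j₂
    predecessorsAgree-ps {j₁} {j₂} ne₁ ne₂ same with position j₁ ne₁ | position j₂ ne₂
    ... | first gaps₁ _  | first gaps₂ _     = predecessorsAgree-common before start≤q gaps₁ gaps₂
    ... | inner k _ _ _ δ₁≡ | first _ δ₂≡    = ⊥-elim (first≢inner k δ₁≡ δ₂≡ same)
    ... | first _ δ₁≡ | inner k _ _ _ δ₂≡    = ⊥-elim (first≢inner k δ₂≡ δ₁≡ (sym same))
    ... | inner _ q≡₁ start≤x ne₁′ _ | inner _ q≡₂ _ ne₂′ _ with suc-injective (trans (sym q≡₁) q≡₂)
    ...   | refl = predecessorsAgree-inner q≡₁ start≤x ne₁′ ne₂′ same

  predecessorsAgree : ∀ {q j₁ j₂} → Nonempty j₁ q → Nonempty j₂ q → sameRule (region q) j₁ j₂ q →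
                      PredecessorsAgree q j₁ j₂
  predecessorsAgree {q} ne₁ ne₂ same with region q | LayoutFrom.column layoutFacts q z≤n
  ... | nothing        | _  = ⊥-elim same
  ... | just (csR , _) | cp = predecessorsAgree-common cp ≤-refl no-gaps no-gaps
  ... | just (psR , _) | _ , block , start≤q , q<e =
    PsColumn.predecessorsAgree-ps block start≤q q<e ne₁ ne₂ same

  predecessorsShareASuffix : ∀ {j₀ q₀ j₁ q₁ q₁′ j₂ q₂ q₂′ σ} →
    SameASuffix j₀ q₀ j₁ q₁ → IsPrev j₁ q₁ q₁′ → cell j₁ q₁′ ≡ just σ →
    SameASuffix j₀ q₀ j₂ q₂ → IsPrev j₂ q₂ q₂′ → cell j₂ q₂′ ≡ just σ →
    SameASuffix j₁ q₁′ j₂ q₂′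
  predecessorsShareASuffix {q₀ = q₀} (refl , _ , ne₁ , same₁) prev₁ c₁ (refl , _ , ne₂ , same₂) prev₂ c₂
    with predecessorsAgree ne₁ ne₂ (sameRule-euclidean (region q₀) same₁ same₂) prev₁ prev₂ c₁ c₂
  ... | refl , same = refl , (_ , c₁) , (_ , c₂) , same

lemma1 : (I : Input) → WellFormed I →
         let open Input I
             open Alignment I
         in (j₀ : Fin m) (q₀ : ℕ) → Nonempty j₀ q₀ →
            (σ : Char) →
            Σ (Fin m) (λ j → Σ ℕ λ q → Σ ℕ λ q' →
               SameASuffix j₀ q₀ j q × IsPrev j q q' × cell j q' ≡ just σ) →
            Σ (Fin m) λ j₁ → Σ ℕ λ q₁ → Nonempty j₁ q₁ ×
              (∀ (j : Fin m) (q q' : ℕ) → SameASuffix j₀ q₀ j q → IsPrev j q q' →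
                 cell j q' ≡ just σ → SameASuffix j₁ q₁ j q')
lemma1 I wf _ _ _ σ (j , q , q′ , sameASuffix , prev , prevChar) =
  j , q′ , (σ , prevChar) , λ _ _ _ sameASuffix₂ prev₂ prevChar₂ →
    predecessorsShareASuffix sameASuffix prev prevChar sameASuffix₂ prev₂ prevChar₂
  where open AlignmentFacts I wf
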